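{- Let $G$ be a uniquely distinguishing colorable graph having at least two pendant vertices with a common neighbor. Then $G$ is a star graph.
   Context: A distinguishing $k$-coloring of a graph is a partition of its vertex set into exactly $k$ non-empty independent sets such that only the identity automorphism maps every class onto itself; $\chi_D$ is the least such $k$. A graph is uniquely distinguishing colorable if there is exactly one partition of its vertex set into $\chi_D$ classes forming a distinguishing coloring. A pendant vertex is a vertex of degree one. -}

module Defs where

open import Data.Nat using (ℕ; _<_)
open import Data.Bool using (Bool; true; false; if_then_else_)
open import Data.Fin using (Fin)
open import Data.Fin.Permutation using (Permutation′; _⟨$⟩ʳ_)
open import Data.List using (map; allFin)
open import Data.Nat.ListAction using (sum)
open import Data.Product using (Σ; ∃; _×_; _,_)
open import Data.Sum using (_⊎_)
open import Relation.Binary.PropositionalEquality using (_≡_; _≢_)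
open import Relation.Nullary using (¬_)
open import Function.Bundles using (_⇔_)

record Graph : Set where
  field
    n      : ℕ
    adj    : Fin n → Fin n → Bool
    sym    : ∀ i j → adj i j ≡ adj j i
    irrefl : ∀ i → adj i i ≡ false

module _ (G : Graph) where
  open Graph G

  Edge : Fin n → Fin n → Set
  Edge i j = adj i j ≡ true

  degree : Fin n → ℕ
  degree i = sum (map (λ j → if adj i j then 1 else 0) (allFin n))

  Pendant : Fin n → Set
  Pendant i = degree i ≡ 1

  IsAutomorphism : Permutation′ n → Set
  IsAutomorphism σ = ∀ i j → adj (σ ⟨$⟩ʳ i) (σ ⟨$⟩ʳ j) ≡ adj i j

  -- A k-coloring with exactly k non-empty classes which are independent:
  -- c : Fin n → Fin k surjective and proper.
  record Coloring (k : ℕ) : Set where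
    field
      col      : Fin n → Fin k
      onto     : ∀ (a : Fin k) → ∃ λ i → col i ≡ a
      proper   : ∀ i j → Edge i j → col i ≢ col j

  open Coloring

  -- distinguishing: the only automorphism mapping every colour class onto
  -- itself (equivalently, preserving the colour of each vertex, since σ is
  -- a bijection) is the identity.
  Distinguishing : ∀ {k} → Coloring k → Set
  Distinguishing c = ∀ σ → IsAutomorphism σ →
    (∀ i → col c (σ ⟨$⟩ʳ i) ≡ col c i) → ∀ i → σ ⟨$⟩ʳ i ≡ i

  DistChromaticNumber : ℕ → Set
  DistChromaticNumber k =
    (Σ (Coloring k) Distinguishing) ×
    (∀ k′ → k′ < k → ¬ Σ (Coloring k′) Distinguishing)

  SamePartition : ∀ {k} → Coloring k → Coloring k → Set
  SamePartition c d = ∀ i j → (col c i ≡ col c j) ⇔ (col d i ≡ col d j)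

  UniquelyDistinguishingColorable : Set
  UniquelyDistinguishingColorable = ∃ λ k → DistChromaticNumber k ×
    (∀ (c d : Coloring k) → Distinguishing c → Distinguishing d → SamePartition c d)

  IsStar : Set
  IsStar = ∃ λ (z : Fin n) → ∀ i j → Edge i j ⇔ ((i ≡ z ⊎ j ≡ z) × i ≢ j)

-- Two pendant vertices u, v at a common neighbour w are twins, so swapping them is an
-- automorphism: a distinguishing colouring c separates them, and comparing c with c composed
-- with the swap, uniqueness leaves each of u, v alone in its colour class. Now let x ≠ w be
-- any vertex other than a leaf at w, and recolour x with the colour of u. An automorphism
-- preserving the new colouring fixes v, hence w, hence maps u to a leaf at w, so it fixes u
-- and then x; thus the new colouring is again distinguishing. If x shared its colour, this is
-- a second distinguishing χ_D-colouring with a different partition; otherwise the colour of x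
-- is now unused and we get a distinguishing colouring with χ_D − 1 colours. Hence every
-- vertex other than w is a leaf at w, and G is a star.

module Submission where

open import Defs
open import Data.Bool using (Bool; true; false; if_then_else_)
import Data.Bool.Properties as Bool
open import Data.Empty using (⊥; ⊥-elim)
open import Data.Fin using (Fin; zero; suc; punchIn; punchOut)
open import Data.Fin.Properties
  using (_≟_; all?; nonZeroIndex; punchInᵢ≢i; punchOut-cong; punchOut-injective; punchOut-punchIn)
open import Data.Fin.Permutation
  using (Permutation′; _⟨$⟩ʳ_; _⟨$⟩ˡ_; inverseˡ; inverseʳ; transpose; flip; _∘ₚ_)
open import Data.List using (tabulate)
open import Data.List.Properties using (map-tabulate)
open import Data.Nat using (ℕ; suc; _≤_; _<_; s≤s; z≤n; pred)
open import Data.Nat.ListAction using (sum)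
open import Data.Nat.Properties using (≤-refl; ≤-trans; m≤n+m; n≮n; m≤pred[n]⇒suc[m]≤n)
open import Data.Product using (Σ; ∃; _×_; _,_; proj₁; proj₂)
open import Data.Sum using (_⊎_; inj₁; inj₂; [_,_])
open import Data.Vec.Functional using (updateAt)
open import Data.Vec.Functional.Properties using (updateAt-updates; updateAt-minimal)
open import Function using (id; _∘_; const)
open import Function.Bundles using (mk⇔; Equivalence; Injection)
open import Function.Properties.Inverse using (↔⇒↣)
open import Relation.Binary.PropositionalEquality
  using (_≡_; _≢_; refl; sym; trans; cong; cong₂; subst; module ≡-Reasoning)
open import Relation.Nullary using (¬_; Dec; yes; no; does; contradiction)
open import Relation.Nullary.Decidable using (dec-true; does-⇔)

trueCount : ∀ {m} → (Fin m → Bool) → ℕ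
trueCount h = sum (tabulate (λ j → if h j then 1 else 0))

1≤trueCount : ∀ {m} (h : Fin m → Bool) {a} → h a ≡ true → 1 ≤ trueCount h
1≤trueCount h {zero} ha rewrite ha = s≤s z≤n
1≤trueCount {suc m} h {suc a} ha = ≤-trans (1≤trueCount (h ∘ suc) ha) (m≤n+m _ _)

2≤trueCount : ∀ {m} (h : Fin m → Bool) {a b} →
  h a ≡ true → h b ≡ true → a ≢ b → 2 ≤ trueCount h
2≤trueCount h {zero} {zero} ha hb a≢b = contradiction refl a≢b
2≤trueCount h {zero} {suc b} ha hb a≢b rewrite ha = s≤s (1≤trueCount (h ∘ suc) hb)
2≤trueCount h {suc a} {zero} ha hb a≢b rewrite hb = s≤s (1≤trueCount (h ∘ suc) ha)
2≤trueCount {suc m} h {suc a} {suc b} ha hb a≢b =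
  ≤-trans (2≤trueCount (h ∘ suc) ha hb (a≢b ∘ cong suc)) (m≤n+m _ _)

omitValue : ∀ {A : Set} {m} (f : A → Fin m) (a : Fin m) →
  (∀ x → f x ≢ a) → (∀ b → b ≢ a → ∃ λ x → f x ≡ b) →
  Σ (A → Fin (pred m)) λ g → (∀ b → ∃ λ x → g x ≡ b) × (∀ x y → g x ≡ g y → f x ≡ f y)
omitValue {A} {suc m} f a avoids hits = g , g-onto , g-reflects
  where
  g : A → Fin m
  g x = punchOut (avoids x ∘ sym)
  g-onto : ∀ b → ∃ λ x → g x ≡ b
  g-onto b with hits (punchIn a b) (punchInᵢ≢i a b)
  ... | x , fx≡b = x , trans (punchOut-cong a fx≡b) (punchOut-punchIn a)
  g-reflects : ∀ x y → g x ≡ g y → f x ≡ f y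
  g-reflects x y = punchOut-injective (avoids x ∘ sym) (avoids y ∘ sym)

permutation-injective : ∀ {m} (π : Permutation′ m) {i j} → π ⟨$⟩ʳ i ≡ π ⟨$⟩ʳ j → i ≡ j
permutation-injective π = Injection.injective (↔⇒↣ π)

transpose-left : ∀ {m} (p q : Fin m) → transpose p q ⟨$⟩ʳ p ≡ q
transpose-left p q with p ≟ p
... | yes _ = refl
... | no p≢p = contradiction refl p≢p

transpose-cases : ∀ {m} (p q i : Fin m) →
  (i ≡ p × transpose p q ⟨$⟩ʳ i ≡ q) ⊎ (i ≡ q × transpose p q ⟨$⟩ʳ i ≡ p) ⊎
  transpose p q ⟨$⟩ʳ i ≡ i
transpose-cases p q i with i ≟ p
... | yes i≡p = inj₁ (i≡p , refl)
... | no _ with i ≟ q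
...   | yes i≡q = inj₂ (inj₁ (i≡q , refl))
...   | no _ = inj₂ (inj₂ refl)

module _ (G : Graph) where
  open Graph G renaming (sym to adj-sym)
  open Coloring

  Twins : Fin n → Fin n → Set
  Twins p q = ∀ j → adj p j ≡ adj q j

  Leaf : Fin n → Fin n → Set
  Leaf w p = ∀ j → adj p j ≡ does (j ≟ w)

  leaf? : ∀ w p → Dec (Leaf w p)
  leaf? w p = all? (λ j → adj p j Bool.≟ does (j ≟ w))

  edge⇒≢ : ∀ {i j} → Edge G i j → i ≢ j
  edge⇒≢ {i} e refl = contradiction (trans (sym e) (irrefl i)) λ ()

  degree≡trueCount : ∀ i → degree G i ≡ trueCount (adj i)
  degree≡trueCount i = cong sum (map-tabulate id (λ j → if adj i j then 1 else 0))

  pendant⇒leaf : ∀ {p w} → Pendant G p → Edge G p w → Leaf w p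
  pendant⇒leaf {p} {w} pendant pw j with j ≟ w
  ... | yes refl = pw
  ... | no j≢w with adj p j in pj
  ...   | false = refl
  ...   | true = contradiction
          (subst (2 ≤_) (trans (sym (degree≡trueCount p)) pendant)
            (2≤trueCount (adj p) pw pj (j≢w ∘ sym)))
          (n≮n 1)

  leaf-adj-centre : ∀ {w p} → Leaf w p → Edge G p w
  leaf-adj-centre {w} leaf = trans (leaf w) (dec-true (w ≟ w) refl)

  leaf-neighbour : ∀ {w p j} → Leaf w p → Edge G p j → j ≡ w
  leaf-neighbour {w} {p} {j} leaf pj with j ≟ w | leaf j
  ... | yes j≡w | _ = j≡w
  ... | no _ | pj≡false = contradiction (trans (sym pj) pj≡false) λ ()

  leaves-twins : ∀ {w p q} → Leaf w p → Leaf w q → Twins p q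
  leaves-twins leaf-p leaf-q j = trans (leaf-p j) (sym (leaf-q j))

  leaves-around-centre⇒star : ∀ w → (∀ x → x ≡ w ⊎ Leaf w x) → IsStar G
  leaves-around-centre⇒star w centre-or-leaf = w , λ i j → mk⇔ (to i j) (from i j)
    where
    to : ∀ i j → Edge G i j → (i ≡ w ⊎ j ≡ w) × i ≢ j
    to i j ij with centre-or-leaf i
    ... | inj₁ i≡w = inj₁ i≡w , edge⇒≢ ij
    ... | inj₂ leaf = inj₂ (leaf-neighbour leaf ij) , edge⇒≢ ij
    from : ∀ i j → (i ≡ w ⊎ j ≡ w) × i ≢ j → Edge G i j
    from i j (inj₁ refl , i≢j) with centre-or-leaf j
    ... | inj₁ refl = contradiction refl i≢j
    ... | inj₂ leaf = trans (adj-sym i j) (leaf-adj-centre leaf)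
    from i j (inj₂ refl , i≢j) with centre-or-leaf i
    ... | inj₁ refl = contradiction refl i≢j
    ... | inj₂ leaf = leaf-adj-centre leaf

  flip-automorphism : ∀ π → IsAutomorphism G π → IsAutomorphism G (flip π)
  flip-automorphism π aut i j = begin
    adj (π ⟨$⟩ˡ i) (π ⟨$⟩ˡ j)                   ≡⟨ aut _ _ ⟨
    adj (π ⟨$⟩ʳ (π ⟨$⟩ˡ i)) (π ⟨$⟩ʳ (π ⟨$⟩ˡ j)) ≡⟨ cong₂ adj (inverseʳ π) (inverseʳ π) ⟩
    adj i j                                      ∎
    where open ≡-Reasoning

  ∘ₚ-automorphism : ∀ π ρ → IsAutomorphism G π → IsAutomorphism G ρ → IsAutomorphism G (π ∘ₚ ρ)
  ∘ₚ-automorphism π ρ aut-π aut-ρ i j = trans (aut-ρ _ _) (aut-π i j)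

  automorphism-maps-leaf : ∀ σ {w p} → IsAutomorphism G σ →
    Leaf w p → Leaf (σ ⟨$⟩ʳ w) (σ ⟨$⟩ʳ p)
  automorphism-maps-leaf σ {w} {p} aut leaf j = begin
    adj (σ ⟨$⟩ʳ p) j                  ≡⟨ cong (adj (σ ⟨$⟩ʳ p)) (inverseʳ σ) ⟨
    adj (σ ⟨$⟩ʳ p) (σ ⟨$⟩ʳ (σ ⟨$⟩ˡ j)) ≡⟨ aut p (σ ⟨$⟩ˡ j) ⟩
    adj p (σ ⟨$⟩ˡ j)                  ≡⟨ leaf (σ ⟨$⟩ˡ j) ⟩
    does (σ ⟨$⟩ˡ j ≟ w)               ≡⟨ does-⇔ (mk⇔ to from) (σ ⟨$⟩ˡ j ≟ w) (j ≟ σ ⟨$⟩ʳ w) ⟩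
    does (j ≟ σ ⟨$⟩ʳ w)               ∎
    where
    open ≡-Reasoning
    to : σ ⟨$⟩ˡ j ≡ w → j ≡ σ ⟨$⟩ʳ w
    to e = trans (sym (inverseʳ σ)) (cong (σ ⟨$⟩ʳ_) e)
    from : j ≡ σ ⟨$⟩ʳ w → σ ⟨$⟩ˡ j ≡ w
    from e = trans (cong (σ ⟨$⟩ˡ_) e) (inverseˡ σ)

  automorphism-fixes-centre : ∀ σ {w p} → IsAutomorphism G σ → Leaf w p →
    σ ⟨$⟩ʳ p ≡ p → σ ⟨$⟩ʳ w ≡ w
  automorphism-fixes-centre σ {w} {p} aut leaf σp≡p = leaf-neighbour leaf (begin
    adj p (σ ⟨$⟩ʳ w)           ≡⟨ cong (λ z → adj z (σ ⟨$⟩ʳ w)) σp≡p ⟨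
    adj (σ ⟨$⟩ʳ p) (σ ⟨$⟩ʳ w) ≡⟨ aut p w ⟩
    adj p w                    ≡⟨ leaf-adj-centre leaf ⟩
    true                       ∎)
    where open ≡-Reasoning

  transpose-twins : ∀ {p q} → Twins p q → ∀ i → Twins (transpose p q ⟨$⟩ʳ i) i
  transpose-twins {p} {q} twins i j with transpose-cases p q i
  ... | inj₁ (refl , τi≡q) = trans (cong (λ z → adj z j) τi≡q) (sym (twins j))
  ... | inj₂ (inj₁ (refl , τi≡p)) = trans (cong (λ z → adj z j) τi≡p) (twins j)
  ... | inj₂ (inj₂ τi≡i) = cong (λ z → adj z j) τi≡i

  transpose-twins-automorphism : ∀ {p q} → Twins p q → IsAutomorphism G (transpose p q)
  transpose-twins-automorphism {p} {q} twins i j = begin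
    adj (τ i) (τ j) ≡⟨ transpose-twins twins i (τ j) ⟩
    adj i (τ j)     ≡⟨ adj-sym i (τ j) ⟩
    adj (τ j) i     ≡⟨ transpose-twins twins j i ⟩
    adj j i         ≡⟨ adj-sym j i ⟩
    adj i j         ∎
    where
    open ≡-Reasoning
    τ : Fin n → Fin n
    τ = transpose p q ⟨$⟩ʳ_

  precompose : ∀ {k} (π : Permutation′ n) → IsAutomorphism G π → Coloring G k → Coloring G k
  precompose π aut c = record
    { col    = col c ∘ (π ⟨$⟩ʳ_)
    ; onto   = λ a → let (i , ci≡a) = onto c a in π ⟨$⟩ˡ i , trans (cong (col c) (inverseʳ π)) ci≡a
    ; proper = λ i j ij → proper c _ _ (trans (aut i j) ij)
    }

  -- σ preserves c ∘ π exactly when π σ π⁻¹ preserves c.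
  precompose-distinguishing : ∀ {k} {c : Coloring G k} π (aut : IsAutomorphism G π) →
    Distinguishing G c → Distinguishing G (precompose π aut c)
  precompose-distinguishing {c = c} π aut distinguishing σ aut-σ preserves i = begin
    σ ⟨$⟩ʳ i                   ≡⟨ inverseˡ π ⟨
    π ⟨$⟩ˡ (π ⟨$⟩ʳ (σ ⟨$⟩ʳ i)) ≡⟨ cong (λ z → π ⟨$⟩ˡ (π ⟨$⟩ʳ (σ ⟨$⟩ʳ z))) (inverseˡ π) ⟨
    π ⟨$⟩ˡ (ρ ⟨$⟩ʳ (π ⟨$⟩ʳ i)) ≡⟨ cong (π ⟨$⟩ˡ_) (ρ-identity (π ⟨$⟩ʳ i)) ⟩
    π ⟨$⟩ˡ (π ⟨$⟩ʳ i)          ≡⟨ inverseˡ π ⟩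
    i                          ∎
    where
    open ≡-Reasoning
    ρ : Permutation′ n
    ρ = flip π ∘ₚ σ ∘ₚ π
    aut-ρ : IsAutomorphism G ρ
    aut-ρ = ∘ₚ-automorphism (flip π) (σ ∘ₚ π)
      (flip-automorphism π aut) (∘ₚ-automorphism σ π aut-σ aut)
    ρ-preserves : ∀ j → col c (ρ ⟨$⟩ʳ j) ≡ col c j
    ρ-preserves j = trans (preserves (π ⟨$⟩ˡ j)) (cong (col c) (inverseʳ π))
    ρ-identity : ∀ j → ρ ⟨$⟩ʳ j ≡ j
    ρ-identity = distinguishing ρ aut-ρ ρ-preserves

  module _ {k} (c : Coloring G k) (distinguishing : Distinguishing G c) where

    twins-coloured-apart : ∀ {p q} → Twins p q → p ≢ q → col c p ≢ col c q
    twins-coloured-apart {p} {q} twins p≢q cp≡cq =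
      p≢q (trans (sym τp≡p) (transpose-left p q))
      where
      τ-preserves : ∀ i → col c (transpose p q ⟨$⟩ʳ i) ≡ col c i
      τ-preserves i with transpose-cases p q i
      ... | inj₁ (refl , τi≡q) = trans (cong (col c) τi≡q) (sym cp≡cq)
      ... | inj₂ (inj₁ (refl , τi≡p)) = trans (cong (col c) τi≡p) cp≡cq
      ... | inj₂ (inj₂ τi≡i) = cong (col c) τi≡i
      τp≡p : transpose p q ⟨$⟩ʳ p ≡ p
      τp≡p = distinguishing (transpose p q) (transpose-twins-automorphism {p} {q} twins) τ-preserves p

    module _ (unique : ∀ d → Distinguishing G d → SamePartition G c d) where

      twin-alone-in-class : ∀ {p q x} → Twins p q → p ≢ q → col c x ≡ col c p → x ≡ p
      twin-alone-in-class {p} {q} {x} twins p≢q cx≡cp with transpose-cases p q x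
      ... | inj₁ (x≡p , _) = x≡p
      ... | inj₂ (inj₁ (refl , _)) = contradiction (sym cx≡cp) (twins-coloured-apart twins p≢q)
      ... | inj₂ (inj₂ τx≡x) = contradiction (trans (sym cx≡cp) cx≡cq) (twins-coloured-apart twins p≢q)
        where
        aut : IsAutomorphism G (transpose p q)
        aut = transpose-twins-automorphism {p} {q} twins
        same-partition : SamePartition G c (precompose (transpose p q) aut c)
        same-partition = unique (precompose (transpose p q) aut c)
          (precompose-distinguishing {c = c} (transpose p q) aut distinguishing)
        cτx≡cq : col c (transpose p q ⟨$⟩ʳ x) ≡ col c q
        cτx≡cq = trans (Equivalence.to (same-partition x p) cx≡cp) (cong (col c) (transpose-left p q))
        cx≡cq : col c x ≡ col c q
        cx≡cq = trans (cong (col c) (sym τx≡x)) cτx≡cq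

      module _ {w u v} (u≢v : u ≢ v) (leaf-u : Leaf w u) (leaf-v : Leaf w v) where

        u-alone : ∀ {y} → col c y ≡ col c u → y ≡ u
        u-alone = twin-alone-in-class (leaves-twins leaf-u leaf-v) u≢v

        v-alone : ∀ {y} → col c y ≡ col c v → y ≡ v
        v-alone = twin-alone-in-class (leaves-twins leaf-v leaf-u) (u≢v ∘ sym)

        fixes-u-and-non-leaf : ∀ σ {x} → IsAutomorphism G σ → ¬ Leaf w x → σ ⟨$⟩ʳ v ≡ v →
          (σ ⟨$⟩ʳ u ≡ u ⊎ σ ⟨$⟩ʳ u ≡ x) → (σ ⟨$⟩ʳ x ≡ u ⊎ σ ⟨$⟩ʳ x ≡ x) →
          σ ⟨$⟩ʳ u ≡ u × σ ⟨$⟩ʳ x ≡ x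
        fixes-u-and-non-leaf σ {x} aut non-leaf σv≡v σu∈ux σx∈ux = σu≡u , σx≡x
          where
          leaf-σu : Leaf w (σ ⟨$⟩ʳ u)
          leaf-σu = subst (λ z → Leaf z (σ ⟨$⟩ʳ u))
            (automorphism-fixes-centre σ aut leaf-v σv≡v) (automorphism-maps-leaf σ aut leaf-u)
          σu≢x : σ ⟨$⟩ʳ u ≢ x
          σu≢x σu≡x = non-leaf (subst (Leaf w) σu≡x leaf-σu)
          σu≡u : σ ⟨$⟩ʳ u ≡ u
          σu≡u = [ id , ⊥-elim ∘ σu≢x ] σu∈ux
          σx≢u : σ ⟨$⟩ʳ x ≢ u
          σx≢u σx≡u =
            non-leaf (subst (Leaf w) (permutation-injective σ (trans σu≡u (sym σx≡u))) leaf-u)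
          σx≡x : σ ⟨$⟩ʳ x ≡ x
          σx≡x = [ ⊥-elim ∘ σx≢u , id ] σx∈ux

        module _ {x} (x≢w : x ≢ w) (non-leaf : ¬ Leaf w x) where

          recoloured : Fin n → Fin k
          recoloured = updateAt (col c) x (const (col c u))

          x≢u : x ≢ u
          x≢u refl = non-leaf leaf-u

          recoloured-x : recoloured x ≡ col c u
          recoloured-x = updateAt-updates x (col c)

          recoloured-elsewhere : ∀ {i} → i ≢ x → recoloured i ≡ col c i
          recoloured-elsewhere {i} i≢x = updateAt-minimal i x (col c) i≢x

          recoloured-class-u-off-x : ∀ {i} → i ≢ x → recoloured i ≡ col c u → i ≡ u
          recoloured-class-u-off-x i≢x ri≡cu = u-alone (trans (sym (recoloured-elsewhere i≢x)) ri≡cu)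

          recoloured-class-u : ∀ {i} → recoloured i ≡ col c u → i ≡ u ⊎ i ≡ x
          recoloured-class-u {i} ri≡cu with i ≟ x
          ... | yes i≡x = inj₂ i≡x
          ... | no i≢x = inj₁ (recoloured-class-u-off-x i≢x ri≡cu)

          recoloured-class-v : ∀ {i} → recoloured i ≡ col c v → i ≡ v
          recoloured-class-v {i} ri≡cv with i ≟ x
          ... | yes refl = contradiction (trans (sym recoloured-x) ri≡cv)
                             (twins-coloured-apart (leaves-twins leaf-u leaf-v) u≢v)
          ... | no i≢x = v-alone (trans (sym (recoloured-elsewhere i≢x)) ri≡cv)

          x-not-adjacent-u : ¬ Edge G x u
          x-not-adjacent-u xu = x≢w (leaf-neighbour leaf-u (trans (adj-sym u x) xu))

          recoloured-proper-at-x : ∀ j → Edge G x j → recoloured x ≢ recoloured j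
          recoloured-proper-at-x j xj rx≡rj with j ≟ x
          ... | yes refl = edge⇒≢ xj refl
          ... | no j≢x = x-not-adjacent-u (subst (Edge G x) j≡u xj)
            where
            j≡u : j ≡ u
            j≡u = recoloured-class-u-off-x j≢x (trans (sym rx≡rj) recoloured-x)

          recoloured-proper : ∀ i j → Edge G i j → recoloured i ≢ recoloured j
          recoloured-proper i j ij with i ≟ x | j ≟ x
          ... | yes refl | _ = recoloured-proper-at-x j ij
          ... | no _ | yes refl = recoloured-proper-at-x i (trans (adj-sym x i) ij) ∘ sym
          ... | no i≢x | no j≢x = λ ri≡rj → proper c i j ij
                (trans (sym (recoloured-elsewhere i≢x)) (trans ri≡rj (recoloured-elsewhere j≢x)))

          x≢v : x ≢ v
          x≢v refl = non-leaf leaf-v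

          recoloured-preserving⇒fixes-x : ∀ σ → IsAutomorphism G σ →
            (∀ i → recoloured (σ ⟨$⟩ʳ i) ≡ recoloured i) → σ ⟨$⟩ʳ x ≡ x
          recoloured-preserving⇒fixes-x σ aut preserves = proj₂
            (fixes-u-and-non-leaf σ aut non-leaf
              (recoloured-class-v (trans (preserves v) (recoloured-elsewhere (x≢v ∘ sym))))
              (recoloured-class-u (trans (preserves u) (recoloured-elsewhere (x≢u ∘ sym))))
              (recoloured-class-u (trans (preserves x) recoloured-x)))

          recoloured-preserving⇒preserving : ∀ σ → IsAutomorphism G σ →
            (∀ i → recoloured (σ ⟨$⟩ʳ i) ≡ recoloured i) → ∀ i → col c (σ ⟨$⟩ʳ i) ≡ col c i
          recoloured-preserving⇒preserving σ aut preserves i with i ≟ x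
          ... | yes refl = cong (col c) (recoloured-preserving⇒fixes-x σ aut preserves)
          ... | no i≢x = begin
            col c (σ ⟨$⟩ʳ i)      ≡⟨ recoloured-elsewhere σi≢x ⟨
            recoloured (σ ⟨$⟩ʳ i) ≡⟨ preserves i ⟩
            recoloured i          ≡⟨ recoloured-elsewhere i≢x ⟩
            col c i               ∎
            where
            open ≡-Reasoning
            σi≢x : σ ⟨$⟩ʳ i ≢ x
            σi≢x σi≡x = i≢x (permutation-injective σ
              (trans σi≡x (sym (recoloured-preserving⇒fixes-x σ aut preserves))))

          recoloured-rigid : ∀ σ → IsAutomorphism G σ →
            (∀ i → recoloured (σ ⟨$⟩ʳ i) ≡ recoloured i) → ∀ i → σ ⟨$⟩ʳ i ≡ i
          recoloured-rigid σ aut preserves =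
            distinguishing σ aut (recoloured-preserving⇒preserving σ aut preserves)

          non-leaf-alone-in-class : ∀ {y} → col c y ≡ col c x → y ≡ x
          non-leaf-alone-in-class {y} cy≡cx with y ≟ x
          ... | yes y≡x = y≡x
          ... | no y≢x = contradiction (u-alone (Equivalence.from (unique d d-distinguishing x u) rx≡ru)) x≢u
            where
            d : Coloring G k
            d = record
              { col    = recoloured
              ; onto   = λ a → let (i , ci≡a) = onto c a in case-x i ci≡a
              ; proper = recoloured-proper
              }
              where
              case-x : ∀ {a} i → col c i ≡ a → ∃ λ j → recoloured j ≡ a
              case-x i ci≡a with i ≟ x
              ... | yes refl = y , trans (recoloured-elsewhere y≢x) (trans cy≡cx ci≡a)
              ... | no i≢x = i , trans (recoloured-elsewhere i≢x) ci≡a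
            d-distinguishing : Distinguishing G d
            d-distinguishing = recoloured-rigid
            rx≡ru : recoloured x ≡ recoloured u
            rx≡ru = trans recoloured-x (sym (recoloured-elsewhere (x≢u ∘ sym)))

          non-leaf-absent : (∀ k′ → k′ < k → ¬ Σ (Coloring G k′) (Distinguishing G)) → ⊥
          non-leaf-absent minimal = minimal (pred k) pred[k]<k (d , d-distinguishing)
            where
            avoids : ∀ i → recoloured i ≢ col c x
            avoids i ri≡cx with i ≟ x
            ... | yes refl = x≢u (u-alone (sym (trans (sym recoloured-x) ri≡cx)))
            ... | no i≢x = i≢x (non-leaf-alone-in-class (trans (sym (recoloured-elsewhere i≢x)) ri≡cx))
            hits : ∀ a → a ≢ col c x → ∃ λ i → recoloured i ≡ a
            hits a a≢cx = let (i , ci≡a) = onto c a in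
              i , trans (recoloured-elsewhere λ { refl → a≢cx (sym ci≡a) }) ci≡a
            squeezed : Σ (Fin n → Fin (pred k)) λ g →
              (∀ b → ∃ λ i → g i ≡ b) × (∀ i j → g i ≡ g j → recoloured i ≡ recoloured j)
            squeezed = omitValue recoloured (col c x) avoids hits
            g-reflects : ∀ i j → proj₁ squeezed i ≡ proj₁ squeezed j → recoloured i ≡ recoloured j
            g-reflects = proj₂ (proj₂ squeezed)
            d : Coloring G (pred k)
            d = record
              { col    = proj₁ squeezed
              ; onto   = proj₁ (proj₂ squeezed)
              ; proper = λ i j ij gi≡gj → recoloured-proper i j ij (g-reflects i j gi≡gj)
              }
            d-distinguishing : Distinguishing G d
            d-distinguishing σ aut preserves = recoloured-rigid σ aut (λ i → g-reflects _ _ (preserves i))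
            pred[k]<k : pred k < k
            pred[k]<k = m≤pred[n]⇒suc[m]≤n ⦃ nonZeroIndex (col c x) ⦄ ≤-refl

        centre-or-leaf : (∀ k′ → k′ < k → ¬ Σ (Coloring G k′) (Distinguishing G)) →
          ∀ x → x ≡ w ⊎ Leaf w x
        centre-or-leaf minimal x with x ≟ w | leaf? w x
        ... | yes x≡w | _ = inj₁ x≡w
        ... | no _ | yes leaf = inj₂ leaf
        ... | no x≢w | no non-leaf = ⊥-elim (non-leaf-absent x≢w non-leaf minimal)

lemma4p3 : (G : Graph) → UniquelyDistinguishingColorable G →
    (∃ λ u → ∃ λ v → ∃ λ w → u ≢ v × Pendant G u × Pendant G v × Edge G u w × Edge G v w) →
    IsStar G
lemma4p3 G (k , ((c , distinguishing) , minimal) , unique) (u , v , w , u≢v , pendant-u , pendant-v , uw , vw) =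
  leaves-around-centre⇒star G w
    (centre-or-leaf G c distinguishing (λ d → unique c d distinguishing) u≢v
      (pendant⇒leaf G pendant-u uw) (pendant⇒leaf G pendant-v vw) minimal)
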